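{- Let $\ell$ be a positive integer, let $\mathcal C=(S_{\mathcal C},\mathcal L_{\mathcal C})$ be an $(\ell+1)$-ample constellation, and let $\mathcal M$ be an induced minor model of a graph $H$ in $\mathcal C$ such that some path $P\in\mathcal L_{\mathcal C}$ is disjoint from all branch sets of $\mathcal M$. Let $z\in S_{\mathcal C}$ belong to the branch set of $\mathcal M$ representing a vertex $u\in V(H)$. Let $H'$ be the graph obtained from $H$ by adding a disjoint path on $2\ell+1$ vertices and making $u$ adjacent to the center of this path. Then there is an induced minor model $\mathcal M'\supset\mathcal M$ of $H'$ in $\mathcal C$ (extending $\mathcal M$ by new branch sets for the new vertices) with $\bigcup\mathcal M'\subseteq\bigcup\mathcal M\cup V(P)$.
   Context: A constellation $\mathcal C=(S_{\mathcal C},\mathcal L_{\mathcal C})$ is a graph with an independent set $S_{\mathcal C}$ such that every connected component of $\mathcal C-S_{\mathcal C}$ is a path, $\mathcal L_{\mathcal C}$ is the set of these paths, and every vertex of $S_{\mathcal C}$ has a neighbour in each path of $\mathcal L_{\mathcal C}$. A $\mathcal C$-route is a path with both endpoints in $S_{\mathcal C}$ and no internal vertex in $S_{\mathcal C}$. $\mathcal C$ is $d$-ample if (i) there is no $\mathcal C$-route with at most $d+1$ edges, and (ii) no vertex of $S_{\mathcal C}$ has a neighbour in a path $P\in\mathcal L_{\mathcal C}$ at distance (in $P$) less than $d$ from an endpoint of $P$. An induced minor model of $H$ in $G$ is a collection $\{X_v: v\in V(H)\}$ of pairwise disjoint connected vertex sets of $G$ (branch sets) such that $X_u$ and $X_v$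 are joined by an edge iff $uv\in E(H)$; $\bigcup\mathcal M$ is the union of its branch sets. -}

module Defs where

open import Data.Nat using (ℕ; zero; suc; _+_; _*_; _∸_; _≤_; _<_)
open import Data.Fin using (Fin; toℕ; fromℕ; inject₁; splitAt)
open import Data.Fin.Subset using (Subset; _∈_; _∉_)
open import Data.Sum using (_⊎_; inj₁; inj₂)
open import Data.Product using (Σ; ∃; ∃-syntax; _×_; _,_)
open import Relation.Nullary using (¬_; Dec)
open import Relation.Binary.PropositionalEquality using (_≡_)

record Graph : Set₁ where
  field
    n       : ℕ
    _~_     : Fin n → Fin n → Set
    ~-sym   : ∀ {x y} → x ~ y → y ~ x
    ~-irrefl : ∀ {x} → ¬ (x ~ x)
    ~-dec   : ∀ x y → Dec (x ~ y)

open Graph public using (n)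

record GPath (G : Graph) : Set where
  open Graph G
  field
    len : ℕ
    vtx : Fin (suc len) → Fin (Graph.n G)
    inj : ∀ i j → vtx i ≡ vtx j → i ≡ j
    adj : ∀ (i : Fin len) → vtx (inject₁ i) ~ vtx (Fin.suc i)

open GPath public

IsInducedPath : (G : Graph) → GPath G → Set
IsInducedPath G P = ∀ i j → Graph._~_ G (vtx P i) (vtx P j) →
  (toℕ i ≡ suc (toℕ j)) ⊎ (toℕ j ≡ suc (toℕ i))

-- L is given as a family of paths
-- L 0, …, L (m-1); the axioms say exactly that the connected components of C - S
-- are these paths (each induced, pairwise disjoint and non-adjacent, covering V(C) ∖ S).
record Constellation (C : Graph) : Set where
  open Graph C
  field
    S        : Subset (Graph.n C)
    S-indep  : ∀ x y → x ∈ S → y ∈ S → ¬ (x ~ y)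
    m        : ℕ
    L        : Fin m → GPath C
    L-induced : ∀ j → IsInducedPath C (L j)
    L-avoidS : ∀ j i → vtx (L j) i ∉ S
    L-cover  : ∀ x → x ∉ S → ∃[ j ] ∃[ i ] (vtx (L j) i ≡ x)
    L-disj   : ∀ j j' i i' → vtx (L j) i ≡ vtx (L j') i' → j ≡ j'
    L-sep    : ∀ j j' i i' → vtx (L j) i ~ vtx (L j') i' → j ≡ j'
    S-touch  : ∀ s → s ∈ S → ∀ j → ∃[ i ] (s ~ vtx (L j) i)

open Constellation public

IsRoute : (C : Graph) → Constellation C → GPath C → Set
IsRoute C K P =
  (1 ≤ len P) × (vtx P Fin.zero ∈ S K) × (vtx P (fromℕ (len P)) ∈ S K) ×
  (∀ i → 0 < toℕ i → toℕ i < len P → vtx P i ∉ S K)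

IsAmple : (C : Graph) → Constellation C → ℕ → Set
IsAmple C K d =
  (∀ (P : GPath C) → IsRoute C K P → ¬ (len P ≤ suc d)) ×
  (∀ s → s ∈ S K → ∀ j i → Graph._~_ C s (vtx (L K j) i) →
     (d ≤ toℕ i) × (d ≤ len (L K j) ∸ toℕ i))

IsConnectedSet : (G : Graph) → Subset (Graph.n G) → Set
IsConnectedSet G X =
  (∃[ x ] (x ∈ X)) ×
  (∀ x y → x ∈ X → y ∈ X → Σ (GPath G) λ P → ((vtx {G} P Fin.zero ≡ x) × (vtx P (fromℕ (len P)) ≡ y)
                                     × (∀ i → vtx P i ∈ X)))

IsIMM : (G : Graph) (h : ℕ) (E : Fin h → Fin h → Set) → (Fin h → Subset (Graph.n G)) → Set
IsIMM G h E X =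
  (∀ v → IsConnectedSet G (X v)) ×
  (∀ u v x → x ∈ X u → x ∈ X v → u ≡ v) ×
  (∀ u v → ¬ (u ≡ v) →
     ((∃[ x ] ∃[ y ] (x ∈ X u × y ∈ X v × Graph._~_ G x y)) → E u v) ×
     (E u v → ∃[ x ] ∃[ y ] (x ∈ X u × y ∈ X v × Graph._~_ G x y)))

-- Adjacency of H' : H plus a disjoint path on 2ℓ+1 new vertices 0..2ℓ,
-- with u joined to the centre ℓ.  Old vertex v is (v ↑ˡ _), new vertex i is (_ ↑ʳ i).
ExtAdj' : (H : Graph) (u : Fin (Graph.n H)) (ℓ : ℕ) →
  Fin (Graph.n H) ⊎ Fin (suc (2 * ℓ)) → Fin (Graph.n H) ⊎ Fin (suc (2 * ℓ)) → Set
ExtAdj' H u ℓ (inj₁ x) (inj₁ y) = Graph._~_ H x y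
ExtAdj' H u ℓ (inj₂ i) (inj₂ j) = (toℕ i ≡ suc (toℕ j)) ⊎ (toℕ j ≡ suc (toℕ i))
ExtAdj' H u ℓ (inj₁ x) (inj₂ i) = (x ≡ u) × (toℕ i ≡ ℓ)
ExtAdj' H u ℓ (inj₂ i) (inj₁ x) = (x ≡ u) × (toℕ i ≡ ℓ)

ExtAdj : (H : Graph) (u : Fin (Graph.n H)) (ℓ : ℕ) →
  Fin (Graph.n H + suc (2 * ℓ)) → Fin (Graph.n H + suc (2 * ℓ)) → Set
ExtAdj H u ℓ a b = ExtAdj' H u ℓ (splitAt (Graph.n H) a) (splitAt (Graph.n H) b)

-- Let a be the first neighbour of z on P and b the last neighbour reachable from a by steps of length at
-- most ℓ + 1 between neighbours of z; by ampleness P extends at least ℓ + 1 beyond both. Collapsing the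
-- index interval [a, b] of P to one point maps [a - ℓ, b + ℓ] stepwise onto a path on 2ℓ + 1 vertices, and
-- since P is induced the fibres form an induced minor model of that path, whose centre contains the
-- neighbour P a of z. Every vertex of the fibres is within distance ℓ along P of a neighbour of z, so an
-- edge to another vertex of S would close a route with at most ℓ + 2 edges; vertices outside S that see P
-- lie on P, which avoids the old branch sets. Hence all edges between old and new branch sets start at z,
-- and they end in the centre because z has no neighbour in [a - ℓ, a) or (b, b + ℓ] by the choice of a, b.

module Submission where

open import Defs
open import Data.Nat
  using (ℕ; zero; suc; _+_; _*_; _∸_; _⊓_; _≤_; _<_; _≤′_; ≤′-refl; ≤′-step; _≟_; _≤?_; _<?_; z≤n; s≤s; s≤s⁻¹; z<s)
open import Data.Nat.Properties
open import Data.Fin as Fin using (Fin; _↑ˡ_; toℕ; fromℕ; fromℕ<; inject₁; opposite; splitAt; join)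
open import Data.Fin.Properties
  using (toℕ-injective; toℕ-fromℕ<; toℕ-inject₁; toℕ≤pred[n]; toℕ<n; toℕ-fromℕ; any?;
         opposite-prop; opposite-involutive; join-splitAt; splitAt-↑ˡ)
open import Data.Fin.Subset using (Subset; _∈_; _∉_)
open import Data.Fin.Subset.Properties using (_∈?_)
open import Data.Vec using (tabulate)
open import Data.Vec.Properties using (lookup∘tabulate; []=⇒lookup; lookup⇒[]=)
open import Data.Vec.Functional using (_∷_)
open import Data.Sum using (_⊎_; inj₁; inj₂; [_,_]; [_,_]′)
open import Function using (id; _∘_)
open import Data.Product using (Σ; _×_; ∃-syntax; _,_; proj₁; proj₂)
open import Relation.Nullary using (¬_; Dec; yes; no; does; contradiction)
open import Relation.Nullary.Decidable using (dec-true; _×-dec_; ¬?; decidable-stable)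
open import Relation.Binary.PropositionalEquality
  using (_≡_; _≢_; ≢-sym; refl; sym; trans; cong; cong₂; subst; subst₂; module ≡-Reasoning)

least-witness : {P : ℕ → Set} → (∀ k → Dec (P k)) → ∀ {k} → P k →
  ∃[ m ] (P m × ∀ j → j < m → ¬ P j)
least-witness {P} P? {k} pk = [ id , (λ none → contradiction pk (none k (n<1+n k))) ]′ (search (suc k))
  where
  search : ∀ k → (∃[ m ] (P m × ∀ j → j < m → ¬ P j)) ⊎ (∀ j → j < k → ¬ P j)
  search zero = inj₂ λ _ ()
  search (suc k) with search k
  ... | inj₁ found = inj₁ found
  ... | inj₂ none with P? k
  ...   | yes pk = inj₁ (k , pk , none)
  ...   | no ¬pk = inj₂ λ j j<1+k → [ none j , (λ { refl → ¬pk }) ]′ (m<1+n⇒m<n∨m≡n j<1+k)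

Stepwise : (ℕ → ℕ) → Set
Stepwise f = ∀ r → f (suc r) ≡ f r ⊎ f (suc r) ≡ suc (f r)

module _ {f : ℕ → ℕ} (step : Stepwise f) where

  stepwise-≤suc : ∀ r → f r ≤ f (suc r)
  stepwise-≤suc r with step r
  ... | inj₁ e = ≤-reflexive (sym e)
  ... | inj₂ e = ≤-trans (n≤1+n (f r)) (≤-reflexive (sym e))

  stepwise-monotone : ∀ {j k} → j ≤ k → f j ≤ f k
  stepwise-monotone j≤k = go (≤⇒≤′ j≤k)
    where
    go : ∀ {j k} → j ≤′ k → f j ≤ f k
    go ≤′-refl = ≤-refl
    go (≤′-step h) = ≤-trans (go h) (stepwise-≤suc _)

  stepwise-crossing : ∀ {t} hi → f 0 ≤ t → t < f hi →
    ∃[ r ] (r < hi × f r ≡ t × f (suc r) ≡ suc t)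
  stepwise-crossing zero f0≤t t<f0 = contradiction t<f0 (≤⇒≯ f0≤t)
  stepwise-crossing {t} (suc h) f0≤t t<fh+1 with f h ≤? t
  ... | no fh≰t with stepwise-crossing h f0≤t (≰⇒> fh≰t)
  ...   | r , r<h , at-r = r , m<n⇒m<1+n r<h , at-r
  stepwise-crossing {t} (suc h) f0≤t t<fh+1 | yes fh≤t with step h
  ... | inj₁ e = contradiction (subst (t <_) e t<fh+1) (≤⇒≯ fh≤t)
  ... | inj₂ e = h , n<1+n h , fh≡t , trans e (cong suc fh≡t)
    where
    fh≡t : f h ≡ t
    fh≡t = ≤-antisym fh≤t (s≤s⁻¹ (subst (t <_) e t<fh+1))

  stepwise-hits : ∀ {t} hi → f 0 ≤ t → t ≤ f hi → ∃[ r ] (r ≤ hi × f r ≡ t)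
  stepwise-hits hi f0≤t t≤fhi with m≤n⇒m<n∨m≡n t≤fhi
  ... | inj₂ t≡fhi = hi , ≤-refl , sym t≡fhi
  ... | inj₁ t<fhi with stepwise-crossing hi f0≤t t<fhi
  ...   | r , r<hi , fr≡t , _ = r , <⇒≤ r<hi , fr≡t

collapse : ℕ → ℕ → ℕ → ℕ
collapse a b r = r ⊓ a + (r ∸ b)

module _ {a b : ℕ} (a≤b : a ≤ b) where

  collapse-below : ∀ {r} → r ≤ a → collapse a b r ≡ r
  collapse-below {r} r≤a =
    trans (cong₂ _+_ (m≤n⇒m⊓n≡m r≤a) (m≤n⇒m∸n≡0 (≤-trans r≤a a≤b))) (+-identityʳ r)

  collapse-middle : ∀ {r} → a ≤ r → r ≤ b → collapse a b r ≡ a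
  collapse-middle {r} a≤r r≤b = trans (cong₂ _+_ (m≥n⇒m⊓n≡n a≤r) (m≤n⇒m∸n≡0 r≤b)) (+-identityʳ a)

  collapse-above : ∀ {r} → b ≤ r → collapse a b r ≡ a + (r ∸ b)
  collapse-above b≤r = cong (_+ _) (m≥n⇒m⊓n≡n (≤-trans a≤b b≤r))

  collapse-≤ : ∀ r → collapse a b r ≤ r
  collapse-≤ r = ≤-trans (+-mono-≤ (≤-reflexive (⊓-comm r a)) (∸-monoʳ-≤ r a≤b)) (≤-reflexive (m⊓n+n∸m≡n a r))

  collapse-upper : ∀ {r c} → collapse a b r ≤ a + c → r ≤ b + c
  collapse-upper {r} {c} bound with r ≤? b
  ... | yes r≤b = ≤-trans r≤b (m≤m+n b c)
  ... | no r≰b = ≤-trans (m≤n+m∸n r b)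
    (+-monoʳ-≤ b (+-cancelˡ-≤ a _ _ (subst (_≤ a + c) (collapse-above (<⇒≤ (≰⇒> r≰b))) bound)))

  collapse-stepwise : Stepwise (collapse a b)
  collapse-stepwise r with r <? a | r <? b
  ... | yes r<a | _ = inj₂ (trans (collapse-below r<a) (cong suc (sym (collapse-below (<⇒≤ r<a)))))
  ... | no r≮a | yes r<b =
    inj₁ (trans (collapse-middle (m≤n⇒m≤1+n (≮⇒≥ r≮a)) r<b) (sym (collapse-middle (≮⇒≥ r≮a) (<⇒≤ r<b))))
  ... | no _ | no r≮b = inj₂ (begin
    collapse a b (suc r) ≡⟨ collapse-above (≤-trans b≤r (n≤1+n r)) ⟩
    a + (suc r ∸ b)      ≡⟨ cong (a +_) (+-∸-assoc 1 b≤r) ⟩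
    a + suc (r ∸ b)      ≡⟨ +-suc a (r ∸ b) ⟩
    suc (a + (r ∸ b))    ≡⟨ cong suc (collapse-above b≤r) ⟨
    suc (collapse a b r) ∎)
    where
    open ≡-Reasoning
    b≤r : b ≤ r
    b≤r = ≮⇒≥ r≮b

Consecutive : ∀ {k} → Fin k → Fin k → Set
Consecutive i j = toℕ i ≡ suc (toℕ j) ⊎ toℕ j ≡ suc (toℕ i)

SumAdj : {I J : Set} → (I → I → Set) → (J → J → Set) → (I → J → Set) → I ⊎ J → I ⊎ J → Set
SumAdj E₁ E₂ F (inj₁ v) (inj₁ w) = E₁ v w
SumAdj E₁ E₂ F (inj₁ v) (inj₂ j) = F v j
SumAdj E₁ E₂ F (inj₂ i) (inj₁ w) = F w i
SumAdj E₁ E₂ F (inj₂ i) (inj₂ j) = E₂ i j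

opposite-fromℕ : ∀ k → opposite (fromℕ k) ≡ Fin.zero
opposite-fromℕ k = toℕ-injective (trans (opposite-prop (fromℕ k)) (trans (cong (k ∸_) (toℕ-fromℕ k)) (n∸n≡0 k)))

opposite-injective : ∀ {k} {i j : Fin k} → opposite i ≡ opposite j → i ≡ j
opposite-injective {i = i} {j} e =
  trans (sym (opposite-involutive i)) (trans (cong opposite e) (opposite-involutive j))

opposite-inject₁ : ∀ {k} (i : Fin k) → opposite (inject₁ i) ≡ Fin.suc (opposite i)
opposite-inject₁ {k} i = toℕ-injective (begin
  toℕ (opposite (inject₁ i))  ≡⟨ opposite-prop (inject₁ i) ⟩
  k ∸ toℕ (inject₁ i)        ≡⟨ cong (k ∸_) (toℕ-inject₁ i) ⟩
  k ∸ toℕ i                  ≡⟨ +-∸-assoc 1 (toℕ<n i) ⟩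
  suc (k ∸ suc (toℕ i))      ≡⟨ cong suc (opposite-prop i) ⟨
  toℕ (Fin.suc (opposite i)) ∎)
  where open ≡-Reasoning

splitAt-injective : ∀ m {k} (w w' : Fin (m + k)) → splitAt m w ≡ splitAt m w' → w ≡ w'
splitAt-injective m {k} w w' e =
  trans (sym (join-splitAt m k w)) (trans (cong (join m k) e) (join-splitAt m k w'))

module _ {k : ℕ} {P : Fin k → Set} (P? : ∀ x → Dec (P x)) where

  subset : Subset k
  subset = tabulate (λ x → does (P? x))

  ∈-subset⁻ : ∀ {x} → x ∈ subset → P x
  ∈-subset⁻ {x} x∈ with P? x | trans (sym (lookup∘tabulate (λ y → does (P? y)) x)) ([]=⇒lookup x∈)
  ... | yes px | _ = px
  ... | no _ | ()

  ∈-subset⁺ : ∀ {x} → P x → x ∈ subset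
  ∈-subset⁺ {x} px = lookup⇒[]= x subset (trans (lookup∘tabulate (λ y → does (P? y)) x) (dec-true (P? x) px))

Touching : (G : Graph) → Subset (n G) → Subset (n G) → Set
Touching G X Y = ∃[ x ] ∃[ y ] (x ∈ X × y ∈ Y × Graph._~_ G x y)

IsModel : (G : Graph) {I : Set} → (I → I → Set) → (I → Subset (n G)) → Set
IsModel G E X =
  (∀ v → IsConnectedSet G (X v)) ×
  (∀ u v x → x ∈ X u → x ∈ X v → u ≡ v) ×
  (∀ u v → ¬ u ≡ v → (Touching G (X u) (X v) → E u v) × (E u v → Touching G (X u) (X v)))

module _ {G : Graph} where
  open Graph G using (_~_; ~-sym)

  index : (P : GPath G) {k : ℕ} → k ≤ len P → Fin (suc (len P))
  index P k≤len = fromℕ< (s≤s k≤len)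

  -- Indices beyond the last one are clamped to it.
  _at_ : GPath G → ℕ → Fin (n G)
  P at k = vtx P (index P (m⊓n≤n k (len P)))

  at-toℕ : ∀ P (i : Fin (suc (len P))) → P at toℕ i ≡ vtx P i
  at-toℕ P i = cong (vtx P) (toℕ-injective (trans (toℕ-fromℕ< _) (m≤n⇒m⊓n≡m (toℕ≤pred[n] i))))

  at-vtx : ∀ P {k} (i : Fin (suc (len P))) → toℕ i ≡ k → P at k ≡ vtx P i
  at-vtx P i refl = at-toℕ P i

  at-index : ∀ P {k} (k≤len : k ≤ len P) → P at k ≡ vtx P (index P k≤len)
  at-index P k≤len = at-vtx P (index P k≤len) (toℕ-fromℕ< (s≤s k≤len))

  at-injective : ∀ P {j k} → j ≤ len P → k ≤ len P → P at j ≡ P at k → j ≡ k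
  at-injective P {j} {k} j≤len k≤len e = begin
    j                    ≡⟨ toℕ-fromℕ< (s≤s j≤len) ⟨
    toℕ (index P j≤len) ≡⟨ cong toℕ (inj P _ _ (trans (sym (at-index P j≤len)) (trans e (at-index P k≤len)))) ⟩
    toℕ (index P k≤len) ≡⟨ toℕ-fromℕ< (s≤s k≤len) ⟩
    k                    ∎
    where open ≡-Reasoning

  at-adjacent : ∀ P {k} → k < len P → (P at k) ~ (P at suc k)
  at-adjacent P {k} k<len =
    subst₂ _~_ (sym (at-vtx P (inject₁ i) (trans (toℕ-inject₁ i) toℕi≡k)))
               (sym (at-vtx P (Fin.suc i) (cong suc toℕi≡k)))
               (adj P i)
    where
    i : Fin (len P)
    i = fromℕ< k<len
    toℕi≡k : toℕ i ≡ k
    toℕi≡k = toℕ-fromℕ< k<len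

  at-induced : ∀ P → IsInducedPath G P → ∀ {j k} → j ≤ len P → k ≤ len P →
    (P at j) ~ (P at k) → j ≡ suc k ⊎ k ≡ suc j
  at-induced P induced {j} {k} j≤len k≤len j~k
    rewrite at-index P j≤len | at-index P k≤len
    with induced (index P j≤len) (index P k≤len) j~k
  ... | inj₁ e = inj₁ (subst₂ (λ x y → x ≡ suc y) (toℕ-fromℕ< (s≤s j≤len)) (toℕ-fromℕ< (s≤s k≤len)) e)
  ... | inj₂ e = inj₂ (subst₂ (λ x y → x ≡ suc y) (toℕ-fromℕ< (s≤s k≤len)) (toℕ-fromℕ< (s≤s j≤len)) e)

  segment : ∀ (P : GPath G) j D → j + D ≤ len P → GPath G
  segment P j D j+D≤len = record
    { len = D
    ; vtx = λ i → P at (j + toℕ i)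
    ; inj = λ i i' e → toℕ-injective (+-cancelˡ-≡ j _ _ (at-injective P (within i) (within i') e))
    ; adj = λ i → subst₂ _~_ (cong (λ x → P at (j + x)) (sym (toℕ-inject₁ i))) (cong (P at_) (sym (+-suc j (toℕ i))))
                    (at-adjacent P (≤-trans (≤-reflexive (sym (+-suc j (toℕ i)))) (within (Fin.suc i))))
    }
    where
    within : ∀ (i : Fin (suc D)) → j + toℕ i ≤ len P
    within i = ≤-trans (+-monoʳ-≤ j (toℕ≤pred[n] i)) j+D≤len

  reverse : GPath G → GPath G
  reverse P = record
    { len = len P
    ; vtx = λ i → vtx P (opposite i)
    ; inj = λ i j e → opposite-injective (inj P _ _ e)
    ; adj = λ i → subst (λ x → vtx P x ~ vtx P (inject₁ (opposite i))) (sym (opposite-inject₁ i))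
                        (~-sym (adj P (opposite i)))
    }

  cons : ∀ x (P : GPath G) → x ~ vtx P Fin.zero → (∀ i → x ≢ vtx P i) → GPath G
  cons x P x~start x∉P = record
    { len = suc (len P)
    ; vtx = x ∷ vtx P
    ; inj = injective
    ; adj = λ { Fin.zero → x~start ; (Fin.suc i) → adj P i }
    }
    where
    injective : ∀ i j → (x ∷ vtx P) i ≡ (x ∷ vtx P) j → i ≡ j
    injective Fin.zero Fin.zero _ = refl
    injective Fin.zero (Fin.suc j) e = contradiction e (x∉P j)
    injective (Fin.suc i) Fin.zero e = contradiction (sym e) (x∉P i)
    injective (Fin.suc i) (Fin.suc j) e = cong Fin.suc (inj P i j e)

  snoc : ∀ (P : GPath G) y → vtx P (fromℕ (len P)) ~ y → (∀ i → y ≢ vtx P i) → GPath G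
  snoc P y end~y y∉P = reverse (cons y (reverse P) (~-sym end~y) (λ i → y∉P (opposite i)))

  module _ (P : GPath G) y (end~y : vtx P (fromℕ (len P)) ~ y) (y∉P : ∀ i → y ≢ vtx P i) where

    snoc-start : vtx (snoc P y end~y y∉P) Fin.zero ≡ vtx P Fin.zero
    snoc-start = cong (vtx P) (opposite-fromℕ (len P))

    snoc-end : vtx (snoc P y end~y y∉P) (fromℕ (suc (len P))) ≡ y
    snoc-end = cong (y ∷ λ i → vtx P (opposite i)) (opposite-fromℕ (suc (len P)))

    snoc-vertex : ∀ i → vtx (snoc P y end~y y∉P) i ≡ y ⊎ ∃[ i' ] (vtx (snoc P y end~y y∉P) i ≡ vtx P i')
    snoc-vertex i with opposite i
    ... | Fin.zero = inj₁ refl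
    ... | Fin.suc i' = inj₂ (opposite i' , refl)

  PathWithin : Subset (n G) → Fin (n G) → Fin (n G) → Set
  PathWithin X x y =
    Σ (GPath G) λ W → (vtx W Fin.zero ≡ x) × (vtx W (fromℕ (len W)) ≡ y) × (∀ i → vtx W i ∈ X)

  PathWithin-reverse : ∀ {X x y} → PathWithin X x y → PathWithin X y x
  PathWithin-reverse (W , start , end , within) =
    reverse W , end , trans (cong (vtx W) (opposite-fromℕ (len W))) start , λ i → within (opposite i)

  Convex : (ℕ → Set) → Set
  Convex R = ∀ {j r k} → R j → R k → j ≤ r → r ≤ k → R r

  convex-connected : ∀ (P : GPath G) (R : ℕ → Set) (X : Subset (n G)) → Convex R →
    (∀ {x} → x ∈ X → ∃[ r ] (r ≤ len P × R r × P at r ≡ x)) →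
    (∀ {r} → r ≤ len P → R r → P at r ∈ X) →
    ∃[ r ] (r ≤ len P × R r) → IsConnectedSet G X
  convex-connected P R X convex members-of-X in-X (r , r≤len , Rr) = (P at r , in-X r≤len Rr) , connect
    where
    ascending : ∀ {j k} → j ≤ k → k ≤ len P → R j → R k → PathWithin X (P at j) (P at k)
    ascending {j} {k} j≤k k≤len Rj Rk =
      segment P j (k ∸ j) (≤-trans (≤-reflexive j+[k∸j]≡k) k≤len) ,
      cong (P at_) (+-identityʳ j) ,
      cong (P at_) (trans (cong (j +_) (toℕ-fromℕ (k ∸ j))) j+[k∸j]≡k) ,
      λ i → in-X (≤-trans (+-monoʳ-≤ j (toℕ≤pred[n] i)) (≤-trans (≤-reflexive j+[k∸j]≡k) k≤len))
                 (convex Rj Rk (m≤m+n j (toℕ i)) (≤-trans (+-monoʳ-≤ j (toℕ≤pred[n] i)) (≤-reflexive j+[k∸j]≡k)))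
      where
      j+[k∸j]≡k : j + (k ∸ j) ≡ k
      j+[k∸j]≡k = m+[n∸m]≡n j≤k
    connect : ∀ x y → x ∈ X → y ∈ X → PathWithin X x y
    connect x y x∈X y∈X with members-of-X x∈X | members-of-X y∈X
    ... | j , j≤len , Rj , refl | k , k≤len , Rk , refl with ≤-total j k
    ...   | inj₁ j≤k = ascending j≤k k≤len Rj Rk
    ...   | inj₂ k≤j = PathWithin-reverse (ascending k≤j j≤len Rk Rj)

  Touching-sym : ∀ {X Y} → Touching G X Y → Touching G Y X
  Touching-sym (x , y , x∈X , y∈Y , x~y) = y , x , y∈Y , x∈X , ~-sym x~y

  IsModel-reindex : ∀ {I J : Set} {E : I → I → Set} {X : I → Subset (n G)} (σ : J → I) →
    (∀ a b → σ a ≡ σ b → a ≡ b) → IsModel G E X → IsModel G (λ a b → E (σ a) (σ b)) (λ a → X (σ a))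
  IsModel-reindex σ σ-injective (connected , disjoint , adjacency) =
    (λ a → connected (σ a)) ,
    (λ a b x x∈a x∈b → σ-injective a b (disjoint (σ a) (σ b) x x∈a x∈b)) ,
    (λ a b a≢b → adjacency (σ a) (σ b) (λ e → a≢b (σ-injective a b e)))

  IsModel-cong : ∀ {I : Set} {E E' : I → I → Set} {X : I → Subset (n G)} →
    (∀ u v → E u v → E' u v) → (∀ u v → E' u v → E u v) → IsModel G E X → IsModel G E' X
  IsModel-cong to from (connected , disjoint , adjacency) =
    connected , disjoint ,
    λ u v u≢v → let (touch⇒E , E⇒touch) = adjacency u v u≢v in to u v ∘ touch⇒E , E⇒touch ∘ from u v

  IsModel-⊎ : ∀ {I J : Set} {E₁ : I → I → Set} {E₂ : J → J → Set} {F : I → J → Set}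
    {X : I → Subset (n G)} {Y : J → Subset (n G)} → IsModel G E₁ X → IsModel G E₂ Y →
    (∀ v i x → x ∈ X v → x ∉ Y i) →
    (∀ v i → Touching G (X v) (Y i) → F v i) → (∀ v i → F v i → Touching G (X v) (Y i)) →
    IsModel G (SumAdj E₁ E₂ F) [ X , Y ]′
  IsModel-⊎ {E₁ = E₁} {E₂} {F} {X} {Y} (connectedX , disjointX , adjacencyX) (connectedY , disjointY , adjacencyY)
            apart touch⇒F F⇒touch =
    [ connectedX , connectedY ] , disjoint , adjacency
    where
    disjoint : ∀ p q x → x ∈ [ X , Y ]′ p → x ∈ [ X , Y ]′ q → p ≡ q
    disjoint (inj₁ v) (inj₁ w) x x∈v x∈w = cong inj₁ (disjointX v w x x∈v x∈w)
    disjoint (inj₁ v) (inj₂ j) x x∈v x∈j = contradiction x∈j (apart v j x x∈v)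
    disjoint (inj₂ i) (inj₁ w) x x∈i x∈w = contradiction x∈i (apart w i x x∈w)
    disjoint (inj₂ i) (inj₂ j) x x∈i x∈j = cong inj₂ (disjointY i j x x∈i x∈j)
    adjacency : ∀ p q → ¬ p ≡ q →
      (Touching G ([ X , Y ]′ p) ([ X , Y ]′ q) → SumAdj E₁ E₂ F p q) ×
      (SumAdj E₁ E₂ F p q → Touching G ([ X , Y ]′ p) ([ X , Y ]′ q))
    adjacency (inj₁ v) (inj₁ w) p≢q = adjacencyX v w (p≢q ∘ cong inj₁)
    adjacency (inj₁ v) (inj₂ j) _ = touch⇒F v j , F⇒touch v j
    adjacency (inj₂ i) (inj₁ w) _ = touch⇒F w i ∘ Touching-sym , Touching-sym ∘ F⇒touch w i
    adjacency (inj₂ i) (inj₂ j) p≢q = adjacencyY i j (p≢q ∘ cong inj₂)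

  module Contraction (Q : GPath G) (Q-induced : IsInducedPath G Q) {f : ℕ → ℕ} (f-step : Stepwise f) where

    InBlock : ℕ → Fin (n G) → Set
    InBlock t x = ∃[ i ] (vtx Q i ≡ x × f (toℕ i) ≡ t)

    InBlock? : ∀ t x → Dec (InBlock t x)
    InBlock? t x = any? (λ i → (vtx Q i Fin.≟ x) ×-dec (f (toℕ i) ≟ t))

    block : ℕ → Subset (n G)
    block t = subset (InBlock? t)

    block⁻ : ∀ {t x} → x ∈ block t → ∃[ r ] (r ≤ len Q × f r ≡ t × Q at r ≡ x)
    block⁻ {t} x∈ with ∈-subset⁻ (InBlock? t) x∈
    ... | i , vtx≡x , fi≡t = toℕ i , toℕ≤pred[n] i , fi≡t , trans (at-toℕ Q i) vtx≡x

    block⁺ : ∀ {t r} → r ≤ len Q → f r ≡ t → Q at r ∈ block t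
    block⁺ {t} r≤len fr≡t =
      ∈-subset⁺ (InBlock? t) (index Q r≤len , sym (at-index Q r≤len) , trans (cong f (toℕ-fromℕ< (s≤s r≤len))) fr≡t)

    block-disjoint : ∀ {t t' x} → x ∈ block t → x ∈ block t' → t ≡ t'
    block-disjoint x∈t x∈t' with block⁻ x∈t | block⁻ x∈t'
    ... | r , r≤len , refl , Qr≡x | r' , r'≤len , refl , Qr'≡x =
      cong f (at-injective Q r≤len r'≤len (trans Qr≡x (sym Qr'≡x)))

    block-connected : ∀ {t} → f 0 ≤ t → t ≤ f (len Q) → IsConnectedSet G (block t)
    block-connected {t} f0≤t t≤f =
      convex-connected Q (λ r → f r ≡ t) (block t) convex block⁻ block⁺ (stepwise-hits f-step (len Q) f0≤t t≤f)
      where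
      convex : Convex (λ r → f r ≡ t)
      convex refl fk≡t j≤r r≤k =
        ≤-antisym (≤-trans (stepwise-monotone f-step r≤k) (≤-reflexive fk≡t)) (stepwise-monotone f-step j≤r)

    block-touching : ∀ {t t'} → Touching G (block t) (block t') → t ≡ t' ⊎ t ≡ suc t' ⊎ t' ≡ suc t
    block-touching (x , y , x∈ , y∈ , x~y) with block⁻ x∈ | block⁻ y∈
    ... | r , r≤len , refl , refl | r' , r'≤len , refl , refl with at-induced Q Q-induced r≤len r'≤len x~y
    ...   | inj₁ refl = [ inj₁ , inj₂ ∘ inj₁ ]′ (f-step r')
    ...   | inj₂ refl = [ inj₁ ∘ sym , inj₂ ∘ inj₂ ]′ (f-step r)

    block-adjacent : ∀ {t} → f 0 ≤ t → suc t ≤ f (len Q) → Touching G (block t) (block (suc t))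
    block-adjacent f0≤t t<f with stepwise-crossing f-step (len Q) f0≤t t<f
    ... | r , r<len , fr≡t , fr+1≡t+1 =
      Q at r , Q at suc r , block⁺ (<⇒≤ r<len) fr≡t , block⁺ r<len fr+1≡t+1 , at-adjacent Q r<len

    contraction-model : ∀ base k → f 0 ≤ base → base + k ≤ f (len Q) →
      IsModel G (Consecutive {suc k}) (λ i → block (base + toℕ i))
    contraction-model base k f0≤base base+k≤f = connected , disjoint , adjacency
      where
      lower : ∀ (i : Fin (suc k)) → f 0 ≤ base + toℕ i
      lower i = ≤-trans f0≤base (m≤m+n base (toℕ i))
      upper : ∀ (i : Fin (suc k)) → base + toℕ i ≤ f (len Q)
      upper i = ≤-trans (+-monoʳ-≤ base (toℕ≤pred[n] i)) base+k≤f
      connected : ∀ i → IsConnectedSet G (block (base + toℕ i))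
      connected i = block-connected (lower i) (upper i)
      disjoint : ∀ i j x → x ∈ block (base + toℕ i) → x ∈ block (base + toℕ j) → i ≡ j
      disjoint i j x x∈i x∈j = toℕ-injective (+-cancelˡ-≡ base _ _ (block-disjoint x∈i x∈j))
      successor : ∀ {i j : Fin (suc k)} → toℕ j ≡ suc (toℕ i) → Touching G (block (base + toℕ i)) (block (base + toℕ j))
      successor {i} {j} j≡i+1 = subst (λ t → Touching G (block (base + toℕ i)) (block t)) e
        (block-adjacent (lower i) (subst (_≤ f (len Q)) (sym e) (upper j)))
        where
        e : suc (base + toℕ i) ≡ base + toℕ j
        e = trans (sym (+-suc base (toℕ i))) (cong (base +_) (sym j≡i+1))
      adjacency : ∀ i j → ¬ i ≡ j →
        (Touching G (block (base + toℕ i)) (block (base + toℕ j)) → Consecutive i j) ×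
        (Consecutive i j → Touching G (block (base + toℕ i)) (block (base + toℕ j)))
      adjacency i j i≢j = touching⇒consecutive , consecutive⇒touching
        where
        touching⇒consecutive : Touching G (block (base + toℕ i)) (block (base + toℕ j)) → Consecutive i j
        touching⇒consecutive touch with block-touching touch
        ... | inj₁ e = contradiction (toℕ-injective (+-cancelˡ-≡ base _ _ e)) i≢j
        ... | inj₂ (inj₁ e) = inj₁ (+-cancelˡ-≡ base _ _ (trans e (sym (+-suc base (toℕ j)))))
        ... | inj₂ (inj₂ e) = inj₂ (+-cancelˡ-≡ base _ _ (trans e (sym (+-suc base (toℕ i)))))
        consecutive⇒touching : Consecutive i j → Touching G (block (base + toℕ i)) (block (base + toℕ j))
        consecutive⇒touching (inj₁ i≡j+1) = Touching-sym (successor i≡j+1)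
        consecutive⇒touching (inj₂ j≡i+1) = successor j≡i+1

module _ {C : Graph} (K : Constellation C) where
  open Graph C using (_~_; ~-sym)

  neighbour-of-path : ∀ j {y r} → y ~ (L K j at r) → y ∈ S K ⊎ ∃[ i ] (vtx (L K j) i ≡ y)
  neighbour-of-path j {y} y~Lj with y ∈? S K
  ... | yes y∈S = inj₁ y∈S
  ... | no y∉S with L-cover K y y∉S
  ...   | j' , i , refl with L-sep K j' j i _ y~Lj
  ...     | refl = inj₂ (i , refl)

  isRoute : ∀ (W : GPath C) → 1 ≤ len W → vtx W Fin.zero ∈ S K → vtx W (fromℕ (len W)) ∈ S K →
    (∀ i → vtx W i ≡ vtx W Fin.zero ⊎ vtx W i ≡ vtx W (fromℕ (len W)) ⊎ vtx W i ∉ S K) → IsRoute C K W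
  isRoute W nontrivial start∈S end∈S vertices = nontrivial , start∈S , end∈S , internal
    where
    internal : ∀ i → 0 < toℕ i → toℕ i < len W → vtx W i ∉ S K
    internal i 0<i i<len with vertices i
    ... | inj₁ at-start = contradiction (cong toℕ (inj W _ _ at-start)) (λ e → <⇒≢ 0<i (sym e))
    ... | inj₂ (inj₁ at-end) = contradiction (trans (cong toℕ (inj W _ _ at-end)) (toℕ-fromℕ (len W))) (<⇒≢ i<len)
    ... | inj₂ (inj₂ i∉S) = i∉S

  module _ (j : Fin (m K)) where
    private
      Lj : GPath C
      Lj = L K j

    route : ∀ {s s' r D} → s ∈ S K → s' ∈ S K → s ≢ s' → r + D ≤ len Lj →
      s ~ (Lj at r) → s' ~ (Lj at (r + D)) → Σ (GPath C) λ W → IsRoute C K W × len W ≡ suc (suc D)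
    route {s} {s'} {r} {D} s∈S s'∈S s≢s' r+D≤len s~r s'~r+D = W , W-route , refl
      where
      seg : GPath C
      seg = segment Lj r D r+D≤len
      seg-off-S : ∀ i → vtx seg i ∉ S K
      seg-off-S i = L-avoidS K j _
      end~s' : vtx seg (fromℕ D) ~ s'
      end~s' = subst (_~ s') (cong (λ x → Lj at (r + x)) (sym (toℕ-fromℕ D))) (~-sym s'~r+D)
      s'∉seg : ∀ i → s' ≢ vtx seg i
      s'∉seg i e = seg-off-S i (subst (_∈ S K) e s'∈S)
      tail : GPath C
      tail = snoc seg s' end~s' s'∉seg
      s~start : s ~ vtx tail Fin.zero
      s~start = subst (s ~_) (sym (trans (snoc-start seg s' end~s' s'∉seg) (cong (Lj at_) (+-identityʳ r)))) s~r
      s∉tail : ∀ i → s ≢ vtx tail i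
      s∉tail i e with snoc-vertex seg s' end~s' s'∉seg i
      ... | inj₁ at-s' = s≢s' (trans e at-s')
      ... | inj₂ (i' , on-seg) = seg-off-S i' (subst (_∈ S K) (trans e on-seg) s∈S)
      W : GPath C
      W = cons s tail s~start s∉tail
      vertices : ∀ i → vtx W i ≡ s ⊎ vtx W i ≡ vtx W (fromℕ (len W)) ⊎ vtx W i ∉ S K
      vertices Fin.zero = inj₁ refl
      vertices (Fin.suc i) with snoc-vertex seg s' end~s' s'∉seg i
      ... | inj₁ at-s' = inj₂ (inj₁ (trans at-s' (sym (snoc-end seg s' end~s' s'∉seg))))
      ... | inj₂ (i' , on-seg) = inj₂ (inj₂ (subst (_∉ S K) (sym on-seg) (seg-off-S i')))
      W-route : IsRoute C K W
      W-route = isRoute W (s≤s z≤n) s∈S (subst (_∈ S K) (sym (snoc-end seg s' end~s' s'∉seg)) s'∈S) vertices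

    module _ {d} (ample : IsAmple C K d) where

      ample-interior : ∀ {s r} → s ∈ S K → r ≤ len Lj → s ~ (Lj at r) → d ≤ r × r + d ≤ len Lj
      ample-interior {s} {r} s∈S r≤len s~r
        with proj₂ ample s s∈S j (index Lj r≤len) (subst (s ~_) (at-index Lj r≤len) s~r)
      ... | d≤i , d≤len∸i =
        subst (d ≤_) toℕi≡r d≤i ,
        ≤-trans (+-monoʳ-≤ r (subst (λ x → d ≤ len Lj ∸ x) toℕi≡r d≤len∸i)) (≤-reflexive (m+[n∸m]≡n r≤len))
        where
        toℕi≡r : toℕ (index Lj r≤len) ≡ r
        toℕi≡r = toℕ-fromℕ< (s≤s r≤len)

      ample-separated : ∀ {s s' r r'} → s ∈ S K → s' ∈ S K → s ≢ s' → r ≤ r' → r' ≤ len Lj →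
        s ~ (Lj at r) → s' ~ (Lj at r') → r + d ≤ r'
      ample-separated {s} {s'} {r} {r'} s∈S s'∈S s≢s' r≤r' r'≤len s~r s'~r' =
        subst (r + d ≤_) r+D≡r' (+-monoʳ-≤ r (≮⇒≥ too-short))
        where
        r+D≡r' : r + (r' ∸ r) ≡ r'
        r+D≡r' = m+[n∸m]≡n r≤r'
        too-short : ¬ (r' ∸ r < d)
        too-short D<d
          with route s∈S s'∈S s≢s' (≤-trans (≤-reflexive r+D≡r') r'≤len) s~r
                     (subst (λ x → s' ~ (Lj at x)) (sym r+D≡r') s'~r')
        ... | W , W-route , len≡ = proj₁ ample W W-route (subst (_≤ suc d) (sym len≡) (s≤s D<d))

module Window {ℓ : ℕ} {C : Graph} (K : Constellation C) (ample : IsAmple C K (suc ℓ))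
  (p : Fin (m K)) {z : Fin (n C)} (z∈S : z ∈ S K) where
  open Graph C using (_~_; ~-dec)

  Q : GPath C
  Q = L K p

  Neighbour : ℕ → Set
  Neighbour c = z ~ (Q at c) × c ≤ len Q

  Neighbour? : ∀ c → Dec (Neighbour c)
  Neighbour? c = ~-dec z (Q at c) ×-dec (c ≤? len Q)

  NeighbourFrom : ℕ → Set
  NeighbourFrom k = ∃[ j ] Neighbour (k + toℕ {suc ℓ} j)

  NeighbourFrom? : ∀ k → Dec (NeighbourFrom k)
  NeighbourFrom? k = any? (λ j → Neighbour? (k + toℕ j))

  abstract
    first : ∃[ a ] (Neighbour a × ∀ c → c < a → ¬ Neighbour c)
    first with S-touch K z z∈S p
    ... | i , z~i = least-witness Neighbour? (subst (z ~_) (sym (at-toℕ Q i)) z~i , toℕ≤pred[n] i)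

  a : ℕ
  a = proj₁ first

  a-neighbour : Neighbour a
  a-neighbour = proj₁ (proj₂ first)

  before-a : ∀ c → c < a → ¬ Neighbour c
  before-a = proj₂ (proj₂ first)

  abstract
    run : ∃[ e ] ((∀ e' → e' ≤ e → NeighbourFrom (a + e')) × ¬ NeighbourFrom (suc (a + e)))
    run = end-of-run (least-witness (λ k → ¬? (NeighbourFrom? (a + k))) beyond)
      where
      beyond : ¬ NeighbourFrom (a + suc (len Q))
      beyond (j , _ , bound) = contradiction (≤-trans (m≤n+m (suc (len Q)) a) (m≤m+n _ (toℕ j))) (<⇒≱ (s≤s bound))
      end-of-run : ∃[ k ] (¬ NeighbourFrom (a + k) × ∀ j → j < k → ¬ ¬ NeighbourFrom (a + j)) →
        ∃[ e ] ((∀ e' → e' ≤ e → NeighbourFrom (a + e')) × ¬ NeighbourFrom (suc (a + e)))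
      end-of-run (zero , none-from-a , _) =
        contradiction (Fin.zero , subst Neighbour (sym (trans (+-identityʳ (a + 0)) (+-identityʳ a))) a-neighbour) none-from-a
      end-of-run (suc e , none-after , some-before) =
        e , (λ e' e'≤e → decidable-stable (NeighbourFrom? (a + e')) (some-before e' (s≤s e'≤e))) ,
        subst (λ x → ¬ NeighbourFrom x) (+-suc a e) none-after

  b : ℕ
  b = a + proj₁ run

  a≤b : a ≤ b
  a≤b = m≤m+n a (proj₁ run)

  covered : ∀ {r} → a ≤ r → r ≤ b → NeighbourFrom r
  covered {r} a≤r r≤b = subst NeighbourFrom (m+[n∸m]≡n a≤r) (proj₁ (proj₂ run) (r ∸ a) (m≤n+o⇒m∸n≤o r a r≤b))

  after-b : ∀ c → b < c → c ≤ b + ℓ → ¬ Neighbour c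
  after-b c b<c c≤b+ℓ neighbour = proj₂ (proj₂ run) (fromℕ< (s≤s offset≤ℓ) , subst Neighbour c≡ neighbour)
    where
    offset≤ℓ : c ∸ suc b ≤ ℓ
    offset≤ℓ = m≤n+o⇒m∸n≤o c (suc b) (≤-trans c≤b+ℓ (n≤1+n (b + ℓ)))
    c≡ : c ≡ suc b + toℕ (fromℕ< (s≤s offset≤ℓ))
    c≡ = sym (trans (cong (suc b +_) (toℕ-fromℕ< (s≤s offset≤ℓ))) (m+[n∸m]≡n b<c))

  b-neighbour : Neighbour b
  b-neighbour with covered a≤b ≤-refl
  ... | Fin.zero , neighbour = subst Neighbour (+-identityʳ b) neighbour
  ... | Fin.suc j , neighbour =
    contradiction neighbour (after-b _ (m<m+n b z<s) (+-monoʳ-≤ b (toℕ≤pred[n] (Fin.suc j))))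

  ℓ<a : ℓ < a
  ℓ<a = proj₁ (ample-interior K p ample z∈S (proj₂ a-neighbour) (proj₁ a-neighbour))

  b+ℓ<len : b + suc ℓ ≤ len Q
  b+ℓ<len = proj₂ (ample-interior K p ample z∈S (proj₂ b-neighbour) (proj₁ b-neighbour))

  b+ℓ≤len : b + ℓ ≤ len Q
  b+ℓ≤len = ≤-trans (+-monoʳ-≤ b (n≤1+n ℓ)) b+ℓ<len

  neighbour-between : ∀ {r} → z ~ (Q at r) → r ≤ b + ℓ → a ≤ r × r ≤ b
  neighbour-between {r} z~r r≤b+ℓ =
    ≮⇒≥ (λ r<a → before-a r r<a (z~r , r≤len)) , ≮⇒≥ (λ b<r → after-b r b<r r≤b+ℓ (z~r , r≤len))
    where
    r≤len : r ≤ len Q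
    r≤len = ≤-trans r≤b+ℓ b+ℓ≤len

  close-neighbour : ∀ {r} → a ∸ ℓ ≤ r → r ≤ b + ℓ →
    ∃[ c ] (Neighbour c × ((r ≤ c × c ≤ r + ℓ) ⊎ (c ≤ r × r ≤ c + ℓ)))
  close-neighbour {r} a∸ℓ≤r r≤b+ℓ with r <? a | r ≤? b
  ... | yes r<a | _ =
    a , a-neighbour , inj₁ (<⇒≤ r<a , ≤-trans (≤-reflexive (sym (m∸n+n≡m (<⇒≤ ℓ<a)))) (+-monoˡ-≤ ℓ a∸ℓ≤r))
  ... | no r≮a | yes r≤b with covered (≮⇒≥ r≮a) r≤b
  ...   | j , neighbour = r + toℕ j , neighbour , inj₁ (m≤m+n r (toℕ j) , +-monoʳ-≤ r (toℕ≤pred[n] j))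
  close-neighbour {r} a∸ℓ≤r r≤b+ℓ | no _ | no r≰b = b , b-neighbour , inj₂ (<⇒≤ (≰⇒> r≰b) , r≤b+ℓ)

  others-apart : ∀ {y r} → y ∈ S K → y ≢ z → a ∸ ℓ ≤ r → r ≤ b + ℓ → ¬ y ~ (Q at r)
  others-apart {y} {r} y∈S y≢z a∸ℓ≤r r≤b+ℓ y~r with close-neighbour a∸ℓ≤r r≤b+ℓ
  ... | c , (z~c , c≤len) , inj₁ (r≤c , c≤r+ℓ) =
    ≤⇒≯ c≤r+ℓ (subst (_≤ c) (+-suc r ℓ) (ample-separated K p ample y∈S z∈S y≢z r≤c c≤len y~r z~c))
  ... | c , (z~c , _) , inj₂ (c≤r , r≤c+ℓ) =
    ≤⇒≯ r≤c+ℓ (subst (_≤ r) (+-suc c ℓ)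
      (ample-separated K p ample z∈S y∈S (≢-sym y≢z) c≤r (≤-trans r≤b+ℓ b+ℓ≤len) z~c y~r))

module Extension (ℓ : ℕ) (C : Graph) (K : Constellation C) (ample : IsAmple C K (suc ℓ))
  (H : Graph) (X : Fin (n H) → Subset (n C)) (X-model : IsIMM C (n H) (Graph._~_ H) X)
  (p : Fin (m K)) (P-free : ∀ i v → vtx (L K p) i ∉ X v)
  (z : Fin (n C)) (u : Fin (n H)) (z∈S : z ∈ S K) (z∈Xu : z ∈ X u) where
  open Graph C using (_~_)
  open Window K ample p z∈S
  open Contraction Q (L-induced K p) (collapse-stepwise a≤b)

  a∸ℓ+ℓ≡a : a ∸ ℓ + ℓ ≡ a
  a∸ℓ+ℓ≡a = m∸n+n≡m (<⇒≤ ℓ<a)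

  a∸ℓ+2ℓ≡a+ℓ : a ∸ ℓ + 2 * ℓ ≡ a + ℓ
  a∸ℓ+2ℓ≡a+ℓ = begin
    a ∸ ℓ + (ℓ + (ℓ + 0)) ≡⟨ +-assoc (a ∸ ℓ) ℓ (ℓ + 0) ⟨
    a ∸ ℓ + ℓ + (ℓ + 0)   ≡⟨ cong₂ _+_ a∸ℓ+ℓ≡a (+-identityʳ ℓ) ⟩
    a + ℓ                 ∎
    where open ≡-Reasoning

  Y : Fin (suc (2 * ℓ)) → Subset (n C)
  Y i = block (a ∸ ℓ + toℕ i)

  Y-model : IsModel C Consecutive Y
  Y-model = contraction-model (a ∸ ℓ) (2 * ℓ) (≤-trans (≤-reflexive (collapse-below a≤b z≤n)) z≤n) (begin
    a ∸ ℓ + 2 * ℓ            ≡⟨ a∸ℓ+2ℓ≡a+ℓ ⟩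
    a + ℓ                    ≤⟨ +-monoʳ-≤ a ℓ≤len∸b ⟩
    a + (len Q ∸ b)          ≡⟨ collapse-above a≤b (m+n≤o⇒m≤o b b+ℓ≤len) ⟨
    collapse a b (len Q)     ∎)
    where
    open ≤-Reasoning
    ℓ≤len∸b : ℓ ≤ len Q ∸ b
    ℓ≤len∸b = ≤-trans (≤-reflexive (sym (m+n∸m≡n b ℓ))) (∸-monoˡ-≤ b b+ℓ≤len)

  apart : ∀ v i x → x ∈ X v → x ∉ Y i
  apart v i x x∈Xv x∈Yi with block⁻ x∈Yi
  ... | r , r≤len , _ , refl = P-free _ v x∈Xv

  Attached : Fin (n H) → Fin (suc (2 * ℓ)) → Set
  Attached v i = v ≡ u × toℕ i ≡ ℓ

  attached⇒touching : ∀ v i → Attached v i → Touching C (X v) (Y i)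
  attached⇒touching v i (refl , i≡ℓ) =
    z , Q at a , z∈Xu , block⁺ (proj₂ a-neighbour) (trans (collapse-below a≤b ≤-refl) (sym a∸ℓ+i≡a)) , proj₁ a-neighbour
    where
    a∸ℓ+i≡a : a ∸ ℓ + toℕ i ≡ a
    a∸ℓ+i≡a = trans (cong (a ∸ ℓ +_) i≡ℓ) a∸ℓ+ℓ≡a

  Y-in-window : ∀ {i : Fin (suc (2 * ℓ))} {r} → collapse a b r ≡ a ∸ ℓ + toℕ i → a ∸ ℓ ≤ r × r ≤ b + ℓ
  Y-in-window {i} {r} collapse≡ =
    ≤-trans (m≤m+n (a ∸ ℓ) (toℕ i)) (≤-trans (≤-reflexive (sym collapse≡)) (collapse-≤ a≤b r)) ,
    collapse-upper a≤b
      (≤-trans (≤-reflexive collapse≡) (≤-trans (+-monoʳ-≤ (a ∸ ℓ) (toℕ≤pred[n] i)) (≤-reflexive a∸ℓ+2ℓ≡a+ℓ)))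

  touching⇒attached : ∀ v i → Touching C (X v) (Y i) → Attached v i
  touching⇒attached v i (x , y , x∈Xv , y∈Yi , x~y) with block⁻ y∈Yi
  ... | r , r≤len , collapse≡ , refl with Y-in-window {i} collapse≡ | neighbour-of-path K p {x} x~y
  ...   | _ , _ | inj₂ (i' , refl) = contradiction x∈Xv (P-free i' v)
  ...   | a∸ℓ≤r , r≤b+ℓ | inj₁ x∈S with x Fin.≟ z
  ...     | no x≢z = contradiction x~y (others-apart x∈S x≢z a∸ℓ≤r r≤b+ℓ)
  ...     | yes refl = proj₁ (proj₂ X-model) v u z x∈Xv z∈Xu , +-cancelˡ-≡ (a ∸ ℓ) _ _ (begin
    a ∸ ℓ + toℕ i         ≡⟨ collapse≡ ⟨
    collapse a b r        ≡⟨ collapse-middle a≤b a≤r r≤b ⟩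
    a                     ≡⟨ a∸ℓ+ℓ≡a ⟨
    a ∸ ℓ + ℓ             ∎)
    where
    open ≡-Reasoning
    a≤r : a ≤ r
    a≤r = proj₁ (neighbour-between x~y r≤b+ℓ)
    r≤b : r ≤ b
    r≤b = proj₂ (neighbour-between x~y r≤b+ℓ)

  extended-model : IsModel C (ExtAdj' H u ℓ) [ X , Y ]′
  extended-model =
    IsModel-cong from-sum to-sum (IsModel-⊎ X-model Y-model apart touching⇒attached attached⇒touching)
    where
    from-sum : ∀ q q' → SumAdj (Graph._~_ H) Consecutive Attached q q' → ExtAdj' H u ℓ q q'
    from-sum (inj₁ _) (inj₁ _) adjacent = adjacent
    from-sum (inj₁ _) (inj₂ _) adjacent = adjacent
    from-sum (inj₂ _) (inj₁ _) adjacent = adjacent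
    from-sum (inj₂ _) (inj₂ _) adjacent = adjacent
    to-sum : ∀ q q' → ExtAdj' H u ℓ q q' → SumAdj (Graph._~_ H) Consecutive Attached q q'
    to-sum (inj₁ _) (inj₁ _) adjacent = adjacent
    to-sum (inj₁ _) (inj₂ _) adjacent = adjacent
    to-sum (inj₂ _) (inj₁ _) adjacent = adjacent
    to-sum (inj₂ _) (inj₂ _) adjacent = adjacent

  contained : ∀ q x → x ∈ [ X , Y ]′ q → (∃[ v ] (x ∈ X v)) ⊎ (∃[ i ] (vtx (L K p) i ≡ x))
  contained (inj₁ v) x x∈Xv = inj₁ (v , x∈Xv)
  contained (inj₂ i) x x∈Yi with block⁻ x∈Yi
  ... | r , _ , _ , Qr≡x = inj₂ (_ , Qr≡x)

-- The construction does not need 1 ≤ ℓ.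
lemma5p1 : (ℓ : ℕ) → 1 ≤ ℓ →
    (C : Graph) (K : Constellation C) → IsAmple C K (suc ℓ) →
    (H : Graph) (X : Fin (n H) → Subset (n C)) → IsIMM C (n H) (Graph._~_ H) X →
    (P : Fin (m K)) → (∀ i v → vtx (L K P) i ∉ X v) →
    (z : Fin (n C)) (u : Fin (n H)) → z ∈ S K → z ∈ X u →
    ∃[ X' ] (IsIMM C (n H + suc (2 * ℓ)) (ExtAdj H u ℓ) X' ×
             (∀ v → X' (v ↑ˡ suc (2 * ℓ)) ≡ X v) ×
             (∀ w x → x ∈ X' w → (∃[ v ] (x ∈ X v)) ⊎ (∃[ i ] (vtx (L K P) i ≡ x))))
lemma5p1 ℓ _ C K ample H X X-model P P-free z u z∈S z∈Xu =
  (λ w → [ X , Y ]′ (splitAt (n H) w)) ,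
  IsModel-reindex (splitAt (n H)) (splitAt-injective (n H)) extended-model ,
  (λ v → cong [ X , Y ]′ (splitAt-↑ˡ (n H) v (suc (2 * ℓ)))) ,
  (λ w → contained (splitAt (n H) w))
  where open Extension ℓ C K ample H X X-model P P-free z u z∈S z∈Xu
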